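{- For all first-order models $\mathfrak M$ with domain $M$, teams $X$ over $\mathfrak M$, and first-order formulas $\xi(\bar v,\bar z)$ over the empty signature, where $\bar v$ is a tuple of variables in the domain of $X$ and $\bar z$ is a tuple of distinct variables not in $\bar v$, \[ \mathfrak M\models_X\top\vee\exists\bar z\,(\mathbf{All}(\bar z)\wedge\neg\xi(\bar v,\bar z))\iff(M,R:=X(\bar v))\models\neg\exists\bar z\,\forall\bar x\,(R\bar x\rightarrow\xi(\bar x,\bar z)), \] where $\neg\xi$ denotes the negation normal form of the negation of $\xi$.
   Context: Team Semantics: all first-order models have domains with at least two elements; first-order formulas are in negation normal form. A team $X$ over a model $\mathfrak M$ with domain $M$ is a set of assignments $s:V\to M$ for a fixed finite set of variables $V$; $X(\bar v)=\{s(\bar v):s\in X\}$. Satisfaction $\mathfrak M\models_X\phi$: for a first-order literal $\alpha$, iff $\mathfrak M\models_s\alpha$ for all $s\in X$ (so $\top$ is satisfied by every team); $\phi_1\vee\phi_2$ iff $X=Y\cup Z$ with $\mathfrak M\models_Y\phi_1$, $\mathfrak M\models_Z\phi_2$; $\phi_1\wedge\phi_2$ iff both hold; $\exists v\psi$ iff there is $H:X\to\mathcal P(M)\setminus\{\emptyset\}$ with $\mathfrak M\models_{X[H/v]}\psi$, $X[H/v]=\{s[m/v]:s\in X,m\in H(s)\}$; $\forall v\psi$ iff $\mathfrak M\models_{X[M/v]}\psi$, $X[M/v]=\{s[m/v]:s\in X,m\in M\}$; $\exists\bar z$ abbreviates repeated single quantifiers. The totality atom: $\mathfrak M\models_X\mathbf{All}(\bar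 z)$ iff $X(\bar z)=M^{|\bar z|}$. $(M,R:=X(\bar v))$ denotes the structure with domain $M$ interpreting the relation symbol $R$ as $X(\bar v)$. -}

module Defs where

open import Data.Nat using (ℕ; zero; suc; _+_)
open import Data.Fin using (Fin; zero; suc; _↑ˡ_; _↑ʳ_; splitAt)
open import Data.Sum using (_⊎_; inj₁; inj₂; [_,_])
open import Data.Product using (Σ; _×_; _,_)
open import Data.Empty using (⊥)
open import Data.Unit using (⊤; tt)
open import Relation.Binary.PropositionalEquality using (_≡_; _≢_)
open import Relation.Nullary using (¬_)
open import Function using (_∘_)
open import Level using (Lift)

-- Variables are de Bruijn indices: a formula of type FO S n has its free
-- variables among Fin n; a quantifier binds the new variable `zero`
-- (the old variables are shifted by `suc`).

record Sig : Set₁ where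
  field
    Rel   : Set
    arity : Rel → ℕ
open Sig public

∅Sig : Sig
∅Sig = record { Rel = ⊥ ; arity = λ () }

RSig : ℕ → Sig
RSig k = record { Rel = ⊤ ; arity = λ _ → k }

data FO (S : Sig) (n : ℕ) : Set where
  ⊤' ⊥'      : FO S n
  _≐_ _≠_    : Fin n → Fin n → FO S n
  rel nrel   : (r : Rel S) → (Fin (arity S r) → Fin n) → FO S n
  _∧'_ _∨'_  : FO S n → FO S n → FO S n
  ∃' ∀'      : FO S (suc n) → FO S n

neg : ∀ {S n} → FO S n → FO S n
neg ⊤'         = ⊥'
neg ⊥'         = ⊤'
neg (x ≐ y)    = x ≠ y
neg (x ≠ y)    = x ≐ y
neg (rel r xs) = nrel r xs
neg (nrel r xs) = rel r xs
neg (φ ∧' ψ)   = neg φ ∨' neg ψ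
neg (φ ∨' ψ)   = neg φ ∧' neg ψ
neg (∃' φ)     = ∀' (neg φ)
neg (∀' φ)     = ∃' (neg φ)

ext : ∀ {n m} → (Fin n → Fin m) → Fin (suc n) → Fin (suc m)
ext ρ zero    = zero
ext ρ (suc i) = suc (ρ i)

ren : ∀ {S n m} → (Fin n → Fin m) → FO S n → FO S m
ren ρ ⊤'          = ⊤'
ren ρ ⊥'          = ⊥'
ren ρ (x ≐ y)     = ρ x ≐ ρ y
ren ρ (x ≠ y)     = ρ x ≠ ρ y
ren ρ (rel r xs)  = rel r (ρ ∘ xs)
ren ρ (nrel r xs) = nrel r (ρ ∘ xs)
ren ρ (φ ∧' ψ)    = ren ρ φ ∧' ren ρ ψ
ren ρ (φ ∨' ψ)    = ren ρ φ ∨' ren ρ ψ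
ren ρ (∃' φ)      = ∃' (ren (ext ρ) φ)
ren ρ (∀' φ)      = ∀' (ren (ext ρ) φ)

emb : ∀ {S n} → FO ∅Sig n → FO S n
emb ⊤'        = ⊤'
emb ⊥'        = ⊥'
emb (x ≐ y)   = x ≐ y
emb (x ≠ y)   = x ≠ y
emb (rel () xs)
emb (nrel () xs)
emb (φ ∧' ψ)  = emb φ ∧' emb ψ
emb (φ ∨' ψ)  = emb φ ∨' emb ψ
emb (∃' φ)    = ∃' (emb φ)
emb (∀' φ)    = ∀' (emb φ)

-- blocks of quantifiers: ∃ⁿ l φ binds the first l variables of Fin (l + n)
∃ⁿ : ∀ {S n} l → FO S (l + n) → FO S n
∃ⁿ zero    φ = φ
∃ⁿ (suc l) φ = ∃ⁿ l (∃' φ)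

∀ⁿ : ∀ {S n} l → FO S (l + n) → FO S n
∀ⁿ zero    φ = φ
∀ⁿ (suc l) φ = ∀ⁿ l (∀' φ)

record Structure (S : Sig) : Set₁ where
  field
    Dom : Set
    Int : (r : Rel S) → (Fin (arity S r) → Dom) → Set
open Structure public

Asg : Set → ℕ → Set
Asg M n = Fin n → M

_▹_ : ∀ {M n} → Asg M n → M → Asg M (suc n)
(s ▹ m) zero    = m
(s ▹ m) (suc i) = s i

_⊨[_]_ : ∀ {S n} (𝔐 : Structure S) → Asg (Dom 𝔐) n → FO S n → Set
𝔐 ⊨[ s ] ⊤'         = ⊤
𝔐 ⊨[ s ] ⊥'         = ⊥
𝔐 ⊨[ s ] (x ≐ y)    = s x ≡ s y
𝔐 ⊨[ s ] (x ≠ y)    = s x ≢ s y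
𝔐 ⊨[ s ] rel r xs   = Int 𝔐 r (s ∘ xs)
𝔐 ⊨[ s ] nrel r xs  = ¬ Int 𝔐 r (s ∘ xs)
𝔐 ⊨[ s ] (φ ∧' ψ)   = (𝔐 ⊨[ s ] φ) × (𝔐 ⊨[ s ] ψ)
𝔐 ⊨[ s ] (φ ∨' ψ)   = (𝔐 ⊨[ s ] φ) ⊎ (𝔐 ⊨[ s ] ψ)
𝔐 ⊨[ s ] ∃' φ       = Σ (Dom 𝔐) λ m → 𝔐 ⊨[ s ▹ m ] φ
𝔐 ⊨[ s ] ∀' φ       = (m : Dom 𝔐) → 𝔐 ⊨[ s ▹ m ] φ

_⊨_ : ∀ {S} (𝔐 : Structure S) → FO S 0 → Set
𝔐 ⊨ φ = 𝔐 ⊨[ (λ ()) ] φ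

-- Team semantics (over the empty signature, models = domains M)

Team : Set → ℕ → Set₁
Team M n = Asg M n → Set

_≡_∪_ : ∀ {M n} → Team M n → Team M n → Team M n → Set
X ≡ Y ∪ Z = (∀ s → X s → Y s ⊎ Z s) × (∀ s → Y s → X s) × (∀ s → Z s → X s)

-- X[H/v] for the new variable v = zero, where H : X → P(M) ∖ {∅}
supp : ∀ {M n} (X : Team M n) → ((s : Asg M n) → X s → M → Set) → Team M (suc n)
supp X H t = Σ (X (t ∘ suc)) λ p → H (t ∘ suc) p (t zero)

dupl : ∀ {M n} → Team M n → Team M (suc n)
dupl X t = X (t ∘ suc)

proj : ∀ {M n k} → Team M n → (Fin k → Fin n) → (Fin k → M) → Set
proj {M} {n} X xs a = Σ (Asg M n) λ s → X s × (∀ i → s (xs i) ≡ a i)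

data TF (n : ℕ) : Set where
  lit   : FO ∅Sig n → TF n            -- only used for literals
  All   : ∀ {l} → (Fin l → Fin n) → TF n
  _∧ᵗ_ _∨ᵗ_ : TF n → TF n → TF n
  ∃ᵗ ∀ᵗ : TF (suc n) → TF n

fo : ∀ {n} → FO ∅Sig n → TF n
fo ⊤'          = lit ⊤'
fo ⊥'          = lit ⊥'
fo (x ≐ y)     = lit (x ≐ y)
fo (x ≠ y)     = lit (x ≠ y)
fo (rel () xs)
fo (nrel () xs)
fo (φ ∧' ψ)    = fo φ ∧ᵗ fo ψ
fo (φ ∨' ψ)    = fo φ ∨ᵗ fo ψ
fo (∃' φ)      = ∃ᵗ (fo φ)
fo (∀' φ)      = ∀ᵗ (fo φ)

∃ᵗⁿ : ∀ {n} l → TF (l + n) → TF n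
∃ᵗⁿ zero    φ = φ
∃ᵗⁿ (suc l) φ = ∃ᵗⁿ l (∃ᵗ φ)

pure : Set → Structure ∅Sig
pure M = record { Dom = M ; Int = λ () }

_⊨ᵀ[_]_ : ∀ {n} (M : Set) → Team M n → TF n → Set₁
M ⊨ᵀ[ X ] lit α   = Lift _ (∀ s → X s → pure M ⊨[ s ] α)
M ⊨ᵀ[ X ] All zs  = Lift _ (∀ b → proj X zs b)
M ⊨ᵀ[ X ] (φ ∧ᵗ ψ) = (M ⊨ᵀ[ X ] φ) × (M ⊨ᵀ[ X ] ψ)
_⊨ᵀ[_]_ {n} M X (φ ∨ᵗ ψ) =
  Σ (Team M n) λ Y → Σ (Team M n) λ Z → X ≡ Y ∪ Z × (M ⊨ᵀ[ Y ] φ) × (M ⊨ᵀ[ Z ] ψ)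
_⊨ᵀ[_]_ {n} M X (∃ᵗ φ) =
  Σ ((s : Asg M n) → X s → M → Set) λ H →
    (∀ s (p : X s) → Σ M (H s p)) × (M ⊨ᵀ[ supp X H ] φ)
M ⊨ᵀ[ X ] ∀ᵗ φ    = M ⊨ᵀ[ dupl X ] φ

-- The two sides of Lemma 8.
-- ξ has free variables among Fin (k + l): the first k are the slots v̄ (resp. x̄),
-- the last l are the slots z̄.

withR : ∀ {M n k} → Team M n → (Fin k → Fin n) → Structure (RSig k)
withR {M} X vs = record { Dom = M ; Int = λ _ a → proj X vs a }

lhsFormula : ∀ {n k l} → (Fin k → Fin n) → FO ∅Sig (k + l) → TF n
lhsFormula {n} {k} {l} vs ξ =
  fo ⊤' ∨ᵗ ∃ᵗⁿ l (All (λ j → j ↑ˡ n) ∧ᵗ fo (neg (ren ρ ξ)))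
  where
    ρ : Fin (k + l) → Fin (l + n)
    ρ = [ (λ i → l ↑ʳ vs i) , (λ j → j ↑ˡ n) ] ∘ splitAt k

-- ¬∃z̄ ∀x̄ (R x̄ → ξ(x̄, z̄)), i.e. the NNF of ¬∃z̄ ∀x̄ (¬R x̄ ∨ ξ(x̄, z̄))
rhsFormula : ∀ {k l} → FO ∅Sig (k + l) → FO (RSig k) 0
rhsFormula {k} {l} ξ =
  neg (∃ⁿ l (∀ⁿ k (nrel tt (λ i → i ↑ˡ (l + 0)) ∨' ren σ (emb ξ))))
  where
    σ : Fin (k + l) → Fin (k + (l + 0))
    σ = [ (λ i → i ↑ˡ (l + 0)) , (λ j → k ↑ʳ (j ↑ˡ 0)) ] ∘ splitAt k

module Submission where

-- Both sides say that R := X(v̄) refutes every value of z̄, i.e. that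
-- M ⊨ ∀z̄ ∃x̄ (R x̄ ∧ ¬ξ(x̄, z̄)). On the right this is the negation pushed
-- inwards. On the left, first-order formulas are flat, so the right disjunct
-- holds for a subteam Z ⊆ X exactly when z̄ can be chosen over Z so that all
-- values of z̄ occur and every resulting assignment satisfies ¬ξ; the ⊤
-- disjunct absorbs the rest of X, and Z = {s ∈ X : ¬ξ(s(v̄), c̄) for some c̄}
-- is the largest choice.

open import Defs
open import Data.Nat using (ℕ; zero; suc; _+_)
open import Data.Fin using (Fin; zero; suc; _↑ˡ_; _↑ʳ_; splitAt)
open import Data.Product using (Σ; Σ-syntax; _×_; _,_; proj₁; proj₂)
open import Data.Sum using (_⊎_; inj₁; inj₂; [_,_])
open import Data.Sum.Properties using ([,]-∘)
open import Data.Unit using (tt)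
open import Data.Vec.Functional using (_++_)
open import Data.Vec.Functional.Properties using (++-cong)
open import Relation.Binary.PropositionalEquality
  using (_≡_; _≢_; _≗_; refl; sym; trans; cong; cong₂; cong-app; subst; module ≡-Reasoning)
open import Relation.Unary using (Pred; _⊆_)
open import Function using (_∘_)
open import Function.Bundles using (_⇔_; mk⇔)
import Function.Properties.Equivalence as ⇔
open import Level using (0ℓ; lift)

neg-ren : ∀ {S n m} (ρ : Fin n → Fin m) (φ : FO S n) → neg (ren ρ φ) ≡ ren ρ (neg φ)
neg-ren ρ ⊤'          = refl
neg-ren ρ ⊥'          = refl
neg-ren ρ (x ≐ y)     = refl
neg-ren ρ (x ≠ y)     = refl
neg-ren ρ (rel r xs)  = refl
neg-ren ρ (nrel r xs) = refl
neg-ren ρ (φ ∧' ψ)    = cong₂ _∨'_ (neg-ren ρ φ) (neg-ren ρ ψ)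
neg-ren ρ (φ ∨' ψ)    = cong₂ _∧'_ (neg-ren ρ φ) (neg-ren ρ ψ)
neg-ren ρ (∃' φ)      = cong ∀' (neg-ren (ext ρ) φ)
neg-ren ρ (∀' φ)      = cong ∃' (neg-ren (ext ρ) φ)

neg-emb : ∀ {S n} (φ : FO ∅Sig n) → neg (emb {S} φ) ≡ emb (neg φ)
neg-emb ⊤'       = refl
neg-emb ⊥'       = refl
neg-emb (x ≐ y)  = refl
neg-emb (x ≠ y)  = refl
neg-emb (φ ∧' ψ) = cong₂ _∨'_ (neg-emb φ) (neg-emb ψ)
neg-emb (φ ∨' ψ) = cong₂ _∧'_ (neg-emb φ) (neg-emb ψ)
neg-emb (∃' φ)   = cong ∀' (neg-emb φ)
neg-emb (∀' φ)   = cong ∃' (neg-emb φ)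

ren-emb : ∀ {S n m} (ρ : Fin n → Fin m) (φ : FO ∅Sig n) → ren ρ (emb {S} φ) ≡ emb (ren ρ φ)
ren-emb ρ ⊤'       = refl
ren-emb ρ ⊥'       = refl
ren-emb ρ (x ≐ y)  = refl
ren-emb ρ (x ≠ y)  = refl
ren-emb ρ (φ ∧' ψ) = cong₂ _∧'_ (ren-emb ρ φ) (ren-emb ρ ψ)
ren-emb ρ (φ ∨' ψ) = cong₂ _∨'_ (ren-emb ρ φ) (ren-emb ρ ψ)
ren-emb ρ (∃' φ)   = cong ∃' (ren-emb (ext ρ) φ)
ren-emb ρ (∀' φ)   = cong ∀' (ren-emb (ext ρ) φ)

neg-ren-emb : ∀ {S n m} (ρ : Fin n → Fin m) (φ : FO ∅Sig n) →
              neg (ren ρ (emb {S} φ)) ≡ emb (ren ρ (neg φ))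
neg-ren-emb ρ φ = begin
  neg (ren ρ (emb φ))  ≡⟨ neg-ren ρ (emb φ) ⟩
  ren ρ (neg (emb φ))  ≡⟨ cong (ren ρ) (neg-emb φ) ⟩
  ren ρ (emb (neg φ))  ≡⟨ ren-emb ρ (neg φ) ⟩
  emb (ren ρ (neg φ))  ∎
  where open ≡-Reasoning

neg-∃ⁿ : ∀ {S n} l (φ : FO S (l + n)) → neg (∃ⁿ l φ) ≡ ∀ⁿ l (neg φ)
neg-∃ⁿ zero    φ = refl
neg-∃ⁿ (suc l) φ = neg-∃ⁿ l (∃' φ)

neg-∀ⁿ : ∀ {S n} l (φ : FO S (l + n)) → neg (∀ⁿ l φ) ≡ ∃ⁿ l (neg φ)
neg-∀ⁿ zero    φ = refl
neg-∀ⁿ (suc l) φ = neg-∀ⁿ l (∀' φ)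

▹-η : ∀ {A : Set} {n} (t : Asg A (suc n)) → (t ∘ suc) ▹ t zero ≗ t
▹-η t zero    = refl
▹-η t (suc i) = refl

▹-cong : ∀ {A : Set} {n} {s s' : Asg A n} → s ≗ s' → ∀ m → s ▹ m ≗ s' ▹ m
▹-cong e m zero    = refl
▹-cong e m (suc i) = e i

▹-ext : ∀ {A : Set} {n m} {ρ : Fin n → Fin m} {s : Asg A m} {s' : Asg A n} →
        s ∘ ρ ≗ s' → ∀ x → (s ▹ x) ∘ ext ρ ≗ s' ▹ x
▹-ext e x zero    = refl
▹-ext e x (suc i) = e i

-- Pointwise this is Data.Vec.Functional._++_, but it unfolds along a block of
-- quantifiers, so satisfaction of ∀ⁿ and ∃ⁿ reduces definitionally.
_⊕_ : ∀ {A : Set} {l n} → (Fin l → A) → Asg A n → Asg A (l + n)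
_⊕_ {l = zero}  c s = s
_⊕_ {l = suc l} c s = ((c ∘ suc) ⊕ s) ▹ c zero

⊕-↑ˡ : ∀ {A : Set} {l n} (c : Fin l → A) (s : Asg A n) → (c ⊕ s) ∘ (_↑ˡ n) ≗ c
⊕-↑ˡ {l = suc l} c s zero    = refl
⊕-↑ˡ {l = suc l} c s (suc i) = ⊕-↑ˡ (c ∘ suc) s i

⊕-↑ʳ : ∀ {A : Set} {l n} (c : Fin l → A) (s : Asg A n) → (c ⊕ s) ∘ (l ↑ʳ_) ≡ s
⊕-↑ʳ {l = zero}  c s = refl
⊕-↑ʳ {l = suc l} c s = ⊕-↑ʳ (c ∘ suc) s

⊨-resp-≗ : ∀ {M n} (φ : FO ∅Sig n) {s s' : Asg M n} → s ≗ s' → pure M ⊨[ s ] φ → pure M ⊨[ s' ] φ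
⊨-resp-≗ ⊤'       e h        = h
⊨-resp-≗ (x ≐ y)  e h        = trans (sym (e x)) (trans h (e y))
⊨-resp-≗ (x ≠ y)  e h        = λ q → h (trans (e x) (trans q (sym (e y))))
⊨-resp-≗ (φ ∧' ψ) e (a , b)  = ⊨-resp-≗ φ e a , ⊨-resp-≗ ψ e b
⊨-resp-≗ (φ ∨' ψ) e (inj₁ a) = inj₁ (⊨-resp-≗ φ e a)
⊨-resp-≗ (φ ∨' ψ) e (inj₂ b) = inj₂ (⊨-resp-≗ ψ e b)
⊨-resp-≗ (∃' φ)   e (m , h)  = m , ⊨-resp-≗ φ (▹-cong e m) h
⊨-resp-≗ (∀' φ)   e h m      = ⊨-resp-≗ φ (▹-cong e m) (h m)

⊨-ren⇒ : ∀ {M n m} (ρ : Fin n → Fin m) (φ : FO ∅Sig n) {s : Asg M m} {s' : Asg M n} →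
         s ∘ ρ ≗ s' → pure M ⊨[ s ] ren ρ φ → pure M ⊨[ s' ] φ
⊨-ren⇒ ρ ⊤'       e h        = h
⊨-ren⇒ ρ (x ≐ y)  e h        = trans (sym (e x)) (trans h (e y))
⊨-ren⇒ ρ (x ≠ y)  e h        = λ q → h (trans (e x) (trans q (sym (e y))))
⊨-ren⇒ ρ (φ ∧' ψ) e (a , b)  = ⊨-ren⇒ ρ φ e a , ⊨-ren⇒ ρ ψ e b
⊨-ren⇒ ρ (φ ∨' ψ) e (inj₁ a) = inj₁ (⊨-ren⇒ ρ φ e a)
⊨-ren⇒ ρ (φ ∨' ψ) e (inj₂ b) = inj₂ (⊨-ren⇒ ρ ψ e b)
⊨-ren⇒ ρ (∃' φ)   e (x , h)  = x , ⊨-ren⇒ (ext ρ) φ (▹-ext e x) h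
⊨-ren⇒ ρ (∀' φ)   e h x      = ⊨-ren⇒ (ext ρ) φ (▹-ext e x) (h x)

⊨-ren⇐ : ∀ {M n m} (ρ : Fin n → Fin m) (φ : FO ∅Sig n) {s : Asg M m} {s' : Asg M n} →
         s ∘ ρ ≗ s' → pure M ⊨[ s' ] φ → pure M ⊨[ s ] ren ρ φ
⊨-ren⇐ ρ ⊤'       e h        = h
⊨-ren⇐ ρ (x ≐ y)  e h        = trans (e x) (trans h (sym (e y)))
⊨-ren⇐ ρ (x ≠ y)  e h        = λ q → h (trans (sym (e x)) (trans q (e y)))
⊨-ren⇐ ρ (φ ∧' ψ) e (a , b)  = ⊨-ren⇐ ρ φ e a , ⊨-ren⇐ ρ ψ e b
⊨-ren⇐ ρ (φ ∨' ψ) e (inj₁ a) = inj₁ (⊨-ren⇐ ρ φ e a)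
⊨-ren⇐ ρ (φ ∨' ψ) e (inj₂ b) = inj₂ (⊨-ren⇐ ρ ψ e b)
⊨-ren⇐ ρ (∃' φ)   e (x , h)  = x , ⊨-ren⇐ (ext ρ) φ (▹-ext e x) h
⊨-ren⇐ ρ (∀' φ)   e h x      = ⊨-ren⇐ (ext ρ) φ (▹-ext e x) (h x)

module _ {S} (𝔐 : Structure S) where

  ⊨-emb⇒ : ∀ {n} (φ : FO ∅Sig n) {s : Asg (Dom 𝔐) n} → 𝔐 ⊨[ s ] emb φ → pure (Dom 𝔐) ⊨[ s ] φ
  ⊨-emb⇒ ⊤'       h        = h
  ⊨-emb⇒ (x ≐ y)  h        = h
  ⊨-emb⇒ (x ≠ y)  h        = h
  ⊨-emb⇒ (φ ∧' ψ) (a , b)  = ⊨-emb⇒ φ a , ⊨-emb⇒ ψ b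
  ⊨-emb⇒ (φ ∨' ψ) (inj₁ a) = inj₁ (⊨-emb⇒ φ a)
  ⊨-emb⇒ (φ ∨' ψ) (inj₂ b) = inj₂ (⊨-emb⇒ ψ b)
  ⊨-emb⇒ (∃' φ)   (x , h)  = x , ⊨-emb⇒ φ h
  ⊨-emb⇒ (∀' φ)   h x      = ⊨-emb⇒ φ (h x)

  ⊨-emb⇐ : ∀ {n} (φ : FO ∅Sig n) {s : Asg (Dom 𝔐) n} → pure (Dom 𝔐) ⊨[ s ] φ → 𝔐 ⊨[ s ] emb φ
  ⊨-emb⇐ ⊤'       h        = h
  ⊨-emb⇐ (x ≐ y)  h        = h
  ⊨-emb⇐ (x ≠ y)  h        = h
  ⊨-emb⇐ (φ ∧' ψ) (a , b)  = ⊨-emb⇐ φ a , ⊨-emb⇐ ψ b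
  ⊨-emb⇐ (φ ∨' ψ) (inj₁ a) = inj₁ (⊨-emb⇐ φ a)
  ⊨-emb⇐ (φ ∨' ψ) (inj₂ b) = inj₂ (⊨-emb⇐ ψ b)
  ⊨-emb⇐ (∃' φ)   (x , h)  = x , ⊨-emb⇐ φ h
  ⊨-emb⇐ (∀' φ)   h x      = ⊨-emb⇐ φ (h x)

  ⊨-∀ⁿ⇒ : ∀ l {n} (φ : FO S (l + n)) {s : Asg (Dom 𝔐) n} →
          𝔐 ⊨[ s ] ∀ⁿ l φ → ∀ c → 𝔐 ⊨[ c ⊕ s ] φ
  ⊨-∀ⁿ⇒ zero    φ h c = h
  ⊨-∀ⁿ⇒ (suc l) φ h c = ⊨-∀ⁿ⇒ l (∀' φ) h (c ∘ suc) (c zero)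

  ⊨-∀ⁿ⇐ : ∀ l {n} (φ : FO S (l + n)) {s : Asg (Dom 𝔐) n} →
          (∀ c → 𝔐 ⊨[ c ⊕ s ] φ) → 𝔐 ⊨[ s ] ∀ⁿ l φ
  ⊨-∀ⁿ⇐ zero    φ h = h (λ ())
  ⊨-∀ⁿ⇐ (suc l) φ h = ⊨-∀ⁿ⇐ l (∀' φ) λ c m → h (c ▹ m)

  ⊨-∃ⁿ⇒ : ∀ l {n} (φ : FO S (l + n)) {s : Asg (Dom 𝔐) n} →
          𝔐 ⊨[ s ] ∃ⁿ l φ → Σ[ c ∈ (Fin l → Dom 𝔐) ] 𝔐 ⊨[ c ⊕ s ] φ
  ⊨-∃ⁿ⇒ zero    φ h = (λ ()) , h
  ⊨-∃ⁿ⇒ (suc l) φ h with ⊨-∃ⁿ⇒ l (∃' φ) h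
  ... | c , m , h' = c ▹ m , h'

  ⊨-∃ⁿ⇐ : ∀ l {n} (φ : FO S (l + n)) {s : Asg (Dom 𝔐) n} →
          Σ[ c ∈ (Fin l → Dom 𝔐) ] 𝔐 ⊨[ c ⊕ s ] φ → 𝔐 ⊨[ s ] ∃ⁿ l φ
  ⊨-∃ⁿ⇐ zero    φ (c , h) = h
  ⊨-∃ⁿ⇐ (suc l) φ (c , h) = ⊨-∃ⁿ⇐ l (∃' φ) (c ∘ suc , c zero , h)

module _ {M : Set} where

  ⊨ᵀ-cong : ∀ {n} (φ : TF n) {X X' : Team M n} → X ⊆ X' → X' ⊆ X →
            M ⊨ᵀ[ X ] φ → M ⊨ᵀ[ X' ] φ
  ⊨ᵀ-cong (lit α)  X⊆X' X'⊆X (lift h) = lift λ s p → h s (X'⊆X p)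
  ⊨ᵀ-cong (All zs) X⊆X' X'⊆X (lift h) = lift λ b → let s , p , e = h b in s , X⊆X' p , e
  ⊨ᵀ-cong (φ ∧ᵗ ψ) X⊆X' X'⊆X (a , b) = ⊨ᵀ-cong φ X⊆X' X'⊆X a , ⊨ᵀ-cong ψ X⊆X' X'⊆X b
  ⊨ᵀ-cong (φ ∨ᵗ ψ) X⊆X' X'⊆X (Y , Z , (cover , Y⊆X , Z⊆X) , a , b) =
    Y , Z , ((λ s p → cover s (X'⊆X p)) , (λ s q → X⊆X' (Y⊆X s q)) , (λ s q → X⊆X' (Z⊆X s q))) , a , b
  ⊨ᵀ-cong (∃ᵗ φ) {X} {X'} X⊆X' X'⊆X (H , nonempty , h) =
    H' , (λ s p → let m , q = nonempty s (X'⊆X p) in m , X'⊆X p , q) ,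
    ⊨ᵀ-cong φ (λ (p , q) → X⊆X' p , p , q) (λ (_ , p , q) → p , q) h
    where
      H' : (s : Asg M _) → X' s → M → Set
      H' s _ m = Σ[ p ∈ X s ] H s p m
  ⊨ᵀ-cong (∀ᵗ φ) X⊆X' X'⊆X h = ⊨ᵀ-cong φ X⊆X' X'⊆X h

  ⊨ᵀ-fo⇒ : ∀ {n} (φ : FO ∅Sig n) {X : Team M n} → M ⊨ᵀ[ X ] fo φ → X ⊆ (pure M ⊨[_] φ)
  ⊨ᵀ-fo⇒ ⊤'       (lift h) {s} p = h s p
  ⊨ᵀ-fo⇒ ⊥'       (lift h) {s} p = h s p
  ⊨ᵀ-fo⇒ (x ≐ y)  (lift h) {s} p = h s p
  ⊨ᵀ-fo⇒ (x ≠ y)  (lift h) {s} p = h s p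
  ⊨ᵀ-fo⇒ (φ ∧' ψ) (a , b) p = ⊨ᵀ-fo⇒ φ a p , ⊨ᵀ-fo⇒ ψ b p
  ⊨ᵀ-fo⇒ (φ ∨' ψ) (Y , Z , (cover , _ , _) , a , b) {s} p with cover s p
  ... | inj₁ y = inj₁ (⊨ᵀ-fo⇒ φ a y)
  ... | inj₂ z = inj₂ (⊨ᵀ-fo⇒ ψ b z)
  ⊨ᵀ-fo⇒ (∃' φ) (H , nonempty , h) {s} p =
    let m , q = nonempty s p in m , ⊨ᵀ-fo⇒ φ h {s ▹ m} (p , q)
  ⊨ᵀ-fo⇒ (∀' φ) h p m = ⊨ᵀ-fo⇒ φ h p

  ⊨ᵀ-fo⇐ : ∀ {n} (φ : FO ∅Sig n) {X : Team M n} → X ⊆ (pure M ⊨[_] φ) → M ⊨ᵀ[ X ] fo φ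
  ⊨ᵀ-fo⇐ ⊤'       f = lift λ _ → f
  ⊨ᵀ-fo⇐ ⊥'       f = lift λ _ → f
  ⊨ᵀ-fo⇐ (x ≐ y)  f = lift λ _ → f
  ⊨ᵀ-fo⇐ (x ≠ y)  f = lift λ _ → f
  ⊨ᵀ-fo⇐ (φ ∧' ψ) f = ⊨ᵀ-fo⇐ φ (proj₁ ∘ f) , ⊨ᵀ-fo⇐ ψ (proj₂ ∘ f)
  ⊨ᵀ-fo⇐ (φ ∨' ψ) {X} f = Y , Z , (cover , (λ _ → proj₁) , (λ _ → proj₁)) , ⊨ᵀ-fo⇐ φ proj₂ , ⊨ᵀ-fo⇐ ψ proj₂
    where
      Y Z : Team M _
      Y s = X s × pure M ⊨[ s ] φ
      Z s = X s × pure M ⊨[ s ] ψ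
      cover : ∀ s → X s → Y s ⊎ Z s
      cover s p with f p
      ... | inj₁ a = inj₁ (p , a)
      ... | inj₂ b = inj₂ (p , b)
  ⊨ᵀ-fo⇐ (∃' φ) f =
    (λ s _ m → pure M ⊨[ s ▹ m ] φ) , (λ _ → f) , ⊨ᵀ-fo⇐ φ λ {t} (_ , q) → ⊨-resp-≗ φ (▹-η t) q
  ⊨ᵀ-fo⇐ (∀' φ) f = ⊨ᵀ-fo⇐ φ λ {t} p → ⊨-resp-≗ φ (▹-η t) (f p (t zero))

  ⊨ᵀ-∃ᵗⁿ⇒ : ∀ l {n} (φ : TF (l + n)) {Z : Team M n} → M ⊨ᵀ[ Z ] ∃ᵗⁿ l φ →
            Σ[ W ∈ Team M (l + n) ] (∀ {t} → W t → Z (t ∘ (l ↑ʳ_))) × M ⊨ᵀ[ W ] φ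
  ⊨ᵀ-∃ᵗⁿ⇒ zero    φ {Z} h = Z , (λ p → p) , h
  ⊨ᵀ-∃ᵗⁿ⇒ (suc l) φ h with ⊨ᵀ-∃ᵗⁿ⇒ l (∃ᵗ φ) h
  ... | V , V⊆Z , H , _ , h' = supp V H , (λ (p , _) → V⊆Z p) , h'

  ⊨ᵀ-∃ᵗⁿ⇐ : ∀ l {n} {Z : Team M n} (Q : Pred (Asg M (l + n)) 0ℓ) →
            (∀ {t t'} → t ≗ t' → Q t → Q t') →
            (∀ {s} → Z s → Σ[ c ∈ (Fin l → M) ] Q (c ⊕ s)) →
            (φ : TF (l + n)) → M ⊨ᵀ[ (λ t → Z (t ∘ (l ↑ʳ_)) × Q t) ] φ → M ⊨ᵀ[ Z ] ∃ᵗⁿ l φ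
  ⊨ᵀ-∃ᵗⁿ⇐ zero Q Q-resp-≗ extends φ h =
    ⊨ᵀ-cong φ proj₁ (λ p → p , proj₂ (extends p)) h
  ⊨ᵀ-∃ᵗⁿ⇐ (suc l) {n} {Z} Q Q-resp-≗ extends φ h =
    ⊨ᵀ-∃ᵗⁿ⇐ l Q' Q'-resp-≗ extends' (∃ᵗ φ)
      ((λ t _ m → Q (t ▹ m)) , (λ _ → proj₂) ,
       ⊨ᵀ-cong φ (λ {t} (z , q) → (z , t zero , Q-resp-≗ (sym ∘ ▹-η t) q) , Q-resp-≗ (sym ∘ ▹-η t) q)
                 (λ {t} ((z , _) , q) → z , Q-resp-≗ (▹-η t) q) h)
    where
      Q' : Pred (Asg M (l + n)) 0ℓ
      Q' t = Σ[ m ∈ M ] Q (t ▹ m)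
      Q'-resp-≗ : ∀ {t t'} → t ≗ t' → Q' t → Q' t'
      Q'-resp-≗ e (m , q) = m , Q-resp-≗ (▹-cong e m) q
      extends' : ∀ {s} → Z s → Σ[ c ∈ (Fin l → M) ] Q' (c ⊕ s)
      extends' p = let c , q = extends p in c ∘ suc , c zero , q

module Refutation {M : Set} {n k l} (X : Team M n) (vs : Fin k → Fin n) (ξ : FO ∅Sig (k + l)) where

  Refuted : Set
  Refuted = ∀ (c : Fin l → M) → Σ[ a ∈ (Fin k → M) ] proj X vs a × pure M ⊨[ a ++ c ] neg ξ

  ρ : Fin (k + l) → Fin (l + n)
  ρ = [ (λ i → l ↑ʳ vs i) , (λ j → j ↑ˡ n) ] ∘ splitAt k

  ∘ρ≗++ : ∀ (t : Asg M (l + n)) {c} → t ∘ (_↑ˡ n) ≗ c → t ∘ ρ ≗ (t ∘ (l ↑ʳ_) ∘ vs) ++ c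
  ∘ρ≗++ t t≗c i = trans ([,]-∘ t (splitAt k i)) (++-cong _ _ (λ _ → refl) t≗c i)

  ⊕-refutes : ∀ c (s : Asg M n) → pure M ⊨[ (s ∘ vs) ++ c ] neg ξ → pure M ⊨[ c ⊕ s ] neg (ren ρ ξ)
  ⊕-refutes c s h = subst (pure M ⊨[ c ⊕ s ]_) (sym (neg-ren ρ ξ)) (⊨-ren⇐ ρ (neg ξ) ⊕∘ρ h)
    where
      ⊕∘ρ : (c ⊕ s) ∘ ρ ≗ (s ∘ vs) ++ c
      ⊕∘ρ i = trans (∘ρ≗++ (c ⊕ s) (⊕-↑ˡ c s) i) (cong (λ s' → ((s' ∘ vs) ++ c) i) (⊕-↑ʳ c s))

  lhs⇒refuted : M ⊨ᵀ[ X ] lhsFormula vs ξ → Refuted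
  lhs⇒refuted (_ , Z , (_ , _ , Z⊆X) , _ , h) c with ⊨ᵀ-∃ᵗⁿ⇒ l _ h
  ... | W , W⊆Z , lift total , ⊨W with total c
  ... | t , p , t≗c =
    t ∘ (l ↑ʳ_) ∘ vs , (t ∘ (l ↑ʳ_) , Z⊆X _ (W⊆Z p) , λ _ → refl) ,
    ⊨-ren⇒ ρ (neg ξ) (∘ρ≗++ t t≗c) (subst (pure M ⊨[ t ]_) (neg-ren ρ ξ) (⊨ᵀ-fo⇒ (neg (ren ρ ξ)) ⊨W p))

  refuted⇒lhs : Refuted → M ⊨ᵀ[ X ] lhsFormula vs ξ
  refuted⇒lhs r =
    X , Z , ((λ _ → inj₁) , (λ _ p → p) , (λ _ → proj₁)) , lift (λ _ _ → tt) ,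
    ⊨ᵀ-∃ᵗⁿ⇐ l Q (⊨-resp-≗ χ) (λ {s} (_ , c , h) → c , ⊕-refutes c s h) _ (lift total , ⊨ᵀ-fo⇐ χ proj₂)
    where
      χ : FO ∅Sig (l + n)
      χ = neg (ren ρ ξ)
      Q : Pred (Asg M (l + n)) 0ℓ
      Q t = pure M ⊨[ t ] χ
      Z : Team M n
      Z s = X s × Σ[ c ∈ (Fin l → M) ] pure M ⊨[ (s ∘ vs) ++ c ] neg ξ
      total : ∀ b → proj (λ t → Z (t ∘ (l ↑ʳ_)) × Q t) (_↑ˡ n) b
      total b with r b
      ... | a , (s , p , s≗a) , h =
        b ⊕ s , (subst Z (sym (⊕-↑ʳ b s)) (p , b , h') , ⊕-refutes b s h') , ⊕-↑ˡ b s
        where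
          h' : pure M ⊨[ (s ∘ vs) ++ b ] neg ξ
          h' = ⊨-resp-≗ (neg ξ) (++-cong _ _ (sym ∘ s≗a) (λ _ → refl)) h

  ⊨lhs⇔refuted : (M ⊨ᵀ[ X ] lhsFormula vs ξ) ⇔ Refuted
  ⊨lhs⇔refuted = mk⇔ lhs⇒refuted refuted⇒lhs

  σ : Fin (k + l) → Fin (k + (l + 0))
  σ = [ (λ i → i ↑ˡ (l + 0)) , (λ j → k ↑ʳ (j ↑ˡ 0)) ] ∘ splitAt k

  Ψ : FO (RSig k) (k + (l + 0))
  Ψ = rel tt (_↑ˡ (l + 0)) ∧' emb (ren σ (neg ξ))

  rhs≡∀∃ : rhsFormula ξ ≡ ∀ⁿ l (∃ⁿ k Ψ)
  rhs≡∀∃ = begin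
    neg (∃ⁿ l (∀ⁿ k (nrel tt (_↑ˡ (l + 0)) ∨' ren σ (emb ξ))))
      ≡⟨ neg-∃ⁿ l _ ⟩
    ∀ⁿ l (neg (∀ⁿ k (nrel tt (_↑ˡ (l + 0)) ∨' ren σ (emb ξ))))
      ≡⟨ cong (∀ⁿ l) (neg-∀ⁿ k _) ⟩
    ∀ⁿ l (∃ⁿ k (rel tt (_↑ˡ (l + 0)) ∧' neg (ren σ (emb ξ))))
      ≡⟨ cong (λ ψ → ∀ⁿ l (∃ⁿ k (rel tt (_↑ˡ (l + 0)) ∧' ψ))) (neg-ren-emb σ ξ) ⟩
    ∀ⁿ l (∃ⁿ k Ψ)
      ∎
    where open ≡-Reasoning

  ⊕∘σ≗++ : ∀ (a : Fin k → M) c (e : Asg M 0) → (a ⊕ (c ⊕ e)) ∘ σ ≗ a ++ c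
  ⊕∘σ≗++ a c e i = trans ([,]-∘ (a ⊕ (c ⊕ e)) (splitAt k i)) (++-cong _ _ (⊕-↑ˡ a (c ⊕ e)) c-part i)
    where
      c-part : ∀ j → (a ⊕ (c ⊕ e)) (k ↑ʳ (j ↑ˡ 0)) ≡ c j
      c-part j = trans (cong-app (⊕-↑ʳ a (c ⊕ e)) (j ↑ˡ 0)) (⊕-↑ˡ c e j)

  R : Structure (RSig k)
  R = withR X vs

  rhs⇒refuted : R ⊨ rhsFormula ξ → Refuted
  rhs⇒refuted h c with ⊨-∃ⁿ⇒ R k Ψ (⊨-∀ⁿ⇒ R l (∃ⁿ k Ψ) (subst (R ⊨_) rhs≡∀∃ h) c)
  ... | a , (s , p , s≗a) , h' =
    a , (s , p , λ i → trans (s≗a i) (⊕-↑ˡ a _ i)) ,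
    ⊨-ren⇒ σ (neg ξ) (⊕∘σ≗++ a c _) (⊨-emb⇒ R (ren σ (neg ξ)) h')

  refuted⇒rhs : Refuted → R ⊨ rhsFormula ξ
  refuted⇒rhs r = subst (R ⊨_) (sym rhs≡∀∃) (⊨-∀ⁿ⇐ R l (∃ⁿ k Ψ) λ c → ⊨-∃ⁿ⇐ R k Ψ (witness c _))
    where
      witness : ∀ c e → Σ[ a ∈ (Fin k → M) ] R ⊨[ a ⊕ (c ⊕ e) ] Ψ
      witness c e with r c
      ... | a , (s , p , s≗a) , h =
        a , (s , p , λ i → trans (s≗a i) (sym (⊕-↑ˡ a _ i))) ,
        ⊨-emb⇐ R (ren σ (neg ξ)) (⊨-ren⇐ σ (neg ξ) (⊕∘σ≗++ a c e) h)

  ⊨rhs⇔refuted : (R ⊨ rhsFormula ξ) ⇔ Refuted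
  ⊨rhs⇔refuted = mk⇔ rhs⇒refuted refuted⇒rhs

lemma8 : (M : Set) → Σ M (λ a → Σ M (λ b → a ≢ b)) →
    (n k l : ℕ) (X : Team M n) (vs : Fin k → Fin n) (ξ : FO ∅Sig (k + l)) →
    (M ⊨ᵀ[ X ] lhsFormula vs ξ) ⇔ (withR X vs ⊨ rhsFormula ξ)
lemma8 M _ n k l X vs ξ = ⇔.trans ⊨lhs⇔refuted (⇔.sym ⊨rhs⇔refuted)
  where open Refutation X vs ξ
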